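{- Let $\lambda$ be a strict partition, $k\ge1$ and $m\ge0$. (i) $\lambda$ has a removable single $k$-ribbon $R$ with $\mathrm{diag}(H(R))=m+k$ if and only if $\lambda$ has a part equal to $m+k$ and no part equal to $m$ (for $m=0$ the latter condition is automatic). In that case $R$ is unique, and $\lambda\setminus R$ is the shifted diagram of the strict partition obtained from $\lambda$ by replacing the part $m+k$ with $m$ (deleting it if $m=0$). (ii) $\lambda$ has a removable double $k$-ribbon with head of diagonal value $a$ if and only if $\lambda$ has parts equal to $a$ and to $k-a$, with $k-a<a$. In that case the ribbon is the unique $R$ such that $\lambda\setminus R$ is the shifted diagram of $\lambda$ with these two parts removed.
   Context: Conventions. Diagrams are drawn in French convention, with rows numbered from the bottom. A strict partition $\lambda=(\lambda_1>\cdots>\lambda_\ell>0)$ is identified with its shifted diagram $\{(c,r):1\le r\le\ell,\ r\le c\le r+\lambda_r-1\}$. The diagonal value is $\mathrm{diag}(c,r)=c-r+1$, and the main diagonal consists of the cells of value $1$. A subset $R\subseteq\lambda$ is removable if $\lambda\setminus R$ is a shifted diagram. Ribbons. A single ribbon is a nonempty edge-connected skew-shifted diagram whose cells have pairwise distinct diagonal values. Its head $H(R)$ and tail $T(R)$ are its cells of largest and smallest diagonal value. A double ribbon in $\lambda$ is a union $R\cup S$ of two disjoint single ribbons with $|R|\ge|S|$ such that $T(R)$ lies on the main diagonal of $\lambda$, $T(S)$ lies on the main diagonal of $\lambda\setminus R$, and $R\cup S$ is skew-shifted. Its head is $H(R)$. A $k$-ribbon is a single or double ribbon with $k$ cells in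 total. -}

module Defs where

open import Data.Nat using (ℕ; zero; suc; _+_; _∸_; _≤_; _<_; _≡ᵇ_; _<ᵇ_)
open import Data.Bool using (if_then_else_)
open import Data.Unit using (⊤)
open import Data.Product using (Σ; ∃; _×_; _,_)
open import Data.Sum using (_⊎_)
open import Data.List using (List; []; _∷_; length; map)
open import Data.List.Membership.Propositional using (_∈_; _∉_)
open import Data.List.Relation.Unary.Unique.Propositional using (Unique)
open import Relation.Nullary using (¬_)
open import Relation.Binary.PropositionalEquality using (_≡_; _≢_)
open import Function.Bundles using (_⇔_)

Strict : List ℕ → Set
Strict []           = ⊤
Strict (x ∷ [])     = 0 < x
Strict (x ∷ y ∷ xs) = y < x × Strict (y ∷ xs)

-- part p r = λ_r (1-based row index r); 0 if r = 0 or r > ℓ(λ).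
part : List ℕ → ℕ → ℕ
part []       _             = 0
part (x ∷ xs) zero          = 0
part (x ∷ xs) (suc zero)    = x
part (x ∷ xs) (suc (suc r)) = part xs (suc r)

-- Cells (c , r): column c, row r (French convention, 1-based).

Cell : Set
Cell = ℕ × ℕ

-- diagonal value c - r + 1 (cells of shifted diagrams satisfy r ≤ c)
diag : Cell → ℕ
diag (c , r) = suc (c ∸ r)

InSD : List ℕ → Cell → Set
InSD p (c , r) = 1 ≤ r × r ≤ c × c < r + part p r

IsShiftedDiagram : (Cell → Set) → Set
IsShiftedDiagram P = Σ (List ℕ) λ μ → Strict μ × (∀ x → P x ⇔ InSD μ x)

IsSkewShifted : (Cell → Set) → Set
IsSkewShifted P =
  Σ (List ℕ) λ μ → Σ (List ℕ) λ ν → Strict μ × Strict ν ×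
    (∀ x → InSD ν x → InSD μ x) ×
    (∀ x → P x ⇔ (InSD μ x × ¬ InSD ν x))

Adj : Cell → Cell → Set
Adj (c , r) (c' , r') =
  (c ≡ c' × (suc r ≡ r' ⊎ suc r' ≡ r)) ⊎ (r ≡ r' × (suc c ≡ c' ⊎ suc c' ≡ c))

data Path (R : List Cell) : Cell → Cell → Set where
  stop : ∀ {x} → Path R x x
  step : ∀ {x y z} → Adj x y → y ∈ R → Path R y z → Path R x z

EdgeConnected : List Cell → Set
EdgeConnected R = ∀ x y → x ∈ R → y ∈ R → Path R x y

IsHead : List Cell → Cell → Set
IsHead R h = h ∈ R × (∀ x → x ∈ R → diag x ≤ diag h)

IsTail : List Cell → Cell → Set
IsTail R t = t ∈ R × (∀ x → x ∈ R → diag t ≤ diag x)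

-- single ribbon: nonempty, edge-connected, skew-shifted,
-- pairwise distinct diagonal values (this also makes the list duplicate-free)
SingleRibbon : List Cell → Set
SingleRibbon R =
  R ≢ [] × EdgeConnected R × IsSkewShifted (λ x → x ∈ R) × Unique (map diag R)

Removable : List ℕ → (Cell → Set) → Set
Removable p P =
  (∀ x → P x → InSD p x) × IsShiftedDiagram (λ x → InSD p x × ¬ P x)

RemovableSingle : List ℕ → ℕ → ℕ → List Cell → Set
RemovableSingle p k d R =
  SingleRibbon R × length R ≡ k × Removable p (λ x → x ∈ R) ×
  Σ Cell (λ h → IsHead R h × diag h ≡ d)

DoubleRibbon : List ℕ → List Cell → List Cell → Set
DoubleRibbon p R S =
  SingleRibbon R × SingleRibbon S × (∀ x → x ∈ R → x ∉ S) ×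
  length S ≤ length R ×
  Σ Cell (λ t → IsTail R t × InSD p t × diag t ≡ 1) ×
  Σ Cell (λ t → IsTail S t × (InSD p t × t ∉ R) × diag t ≡ 1) ×
  IsSkewShifted (λ x → x ∈ R ⊎ x ∈ S)

RemovableDouble : List ℕ → ℕ → ℕ → List Cell → List Cell → Set
RemovableDouble p k a R S =
  DoubleRibbon p R S × length R + length S ≡ k ×
  Removable p (λ x → x ∈ R ⊎ x ∈ S) ×
  Σ Cell (λ h → IsHead R h × diag h ≡ a)

removePart : ℕ → List ℕ → List ℕ
removePart n []       = []
removePart n (x ∷ xs) = if x ≡ᵇ n then xs else x ∷ removePart n xs

insertPart : ℕ → List ℕ → List ℕ
insertPart zero    xs       = xs
insertPart (suc n) []       = suc n ∷ []
insertPart (suc n) (x ∷ xs) =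
  if x <ᵇ suc n then suc n ∷ x ∷ xs else x ∷ insertPart (suc n) xs

replacePart : ℕ → ℕ → List ℕ → List ℕ
replacePart a b xs = insertPart b (removePart a xs)

module Submission where

-- Shifted diagrams are described through their diagonals: for strict μ,
-- diagLen μ d (the number of parts ≥ d) is the number of cells of diagonal
-- value d; a cell (c , r) with r ≤ c lies in the diagram iff
-- r ≤ diagLen μ (diag (c , r)); and e is a part of μ iff the diagonal lengths
-- drop at e.  Deleting or inserting a part changes diagLen by an indicator,
-- so "ν is μ with hi replaced by lo" can be read off the diagonals (Replaces).
--
-- A ribbon meets each diagonal at most once and, being connected, meets an
-- interval of diagonals (DiagonalInterval).  When a set of cells is removed
-- from λ leaving a shifted diagram ν, the removed cells of each diagonal are
-- its top ones (module Removal).  Hence removing a single ribbon shortens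
-- exactly the diagonals m + 1, …, m + k by one (RemovedSingle), and a double
-- ribbon shortens diagonal d by [d ≤ a] + [d ≤ k - a] (RemovedDouble).  This
-- gives the forward implications and the shape of the complement; uniqueness
-- follows because the complement determines the ribbon.  Conversely, the top
-- cells of the diagonals lo + 1, …, hi form a removable single ribbon when
-- hi ∈ μ and lo ∉ μ (TopRibbon); used once, or twice with lo = 0, it yields
-- the ribbons of (i) and (ii).  mainTheorem8 collects these facts.

open import Defs
open import Data.Nat
open import Data.Nat.Properties
open import Algebra.Properties.CommutativeSemigroup +-commutativeSemigroup using (x∙yz≈y∙xz)
open import Data.Bool using (true; false)
open import Data.Unit using (tt)
open import Data.Empty using (⊥; ⊥-elim)
open import Data.Product using (Σ; _×_; _,_; proj₁; proj₂; uncurry)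
open import Data.Product.Properties using (≡-dec)
open import Data.Sum using (_⊎_; inj₁; inj₂)
open import Data.List using (List; []; _∷_; length; map; applyUpTo)
open import Data.List.Properties using (length-map; length-applyUpTo)
open import Data.List.Extrema.Nat
  using (argmin; argmax; argmin-sel; argmax-sel; f[argmin]≤f[⊤]; f[argmin]≤f[xs]; f[⊥]≤f[argmax]; f[xs]≤f[argmax])
open import Data.List.Membership.Propositional using (_∈_; _∉_)
open import Data.List.Membership.Propositional.Properties
  using (∈-map⁺; ∈-map⁻; ∈-applyUpTo⁺; ∈-applyUpTo⁻)
open import Data.List.Relation.Unary.Any using (here; there)
import Data.List.Relation.Unary.All as All
open import Data.List.Relation.Unary.AllPairs using (_∷_)
open import Data.List.Relation.Unary.Unique.Propositional using (Unique)
open import Data.List.Relation.Unary.Unique.Propositional.Properties using (applyUpTo⁺₁)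
open import Relation.Nullary using (¬_; Dec; yes; no)
open import Relation.Nullary.Decidable using (_×-dec_; _⊎-dec_)
open import Relation.Binary.Definitions using (DecidableEquality; tri<; tri≈; tri>)
open import Relation.Binary.PropositionalEquality
open import Function.Bundles using (_⇔_; mk⇔; Equivalence)
open import Function.Construct.Composition using (_⇔-∘_)

open import Data.List.Membership.DecPropositional (≡-dec _≟_ _≟_) using (_∈?_)

hd : List ℕ → ℕ
hd []      = 0
hd (y ∷ _) = y

strict-tail : ∀ {x xs} → Strict (x ∷ xs) → Strict xs
strict-tail {xs = []}    _ = tt
strict-tail {xs = _ ∷ _} s = proj₂ s

strict-head : ∀ {x xs} → Strict (x ∷ xs) → hd xs < x
strict-head {xs = []}    s = s
strict-head {xs = _ ∷ _} s = proj₁ s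

strict-cons : ∀ {x xs} → hd xs < x → Strict xs → Strict (x ∷ xs)
strict-cons {xs = []}    h _ = h
strict-cons {xs = _ ∷ _} h s = h , s

strict-bound : ∀ {x xs y} → Strict (x ∷ xs) → y ∈ xs → y < x
strict-bound {xs = _ ∷ _} s (here refl) = strict-head s
strict-bound {xs = _ ∷ _} s (there y∈) =
  <-trans (strict-bound (strict-tail s) y∈) (strict-head s)

strict-pos : ∀ {xs y} → Strict xs → y ∈ xs → 0 < y
strict-pos {_ ∷ _} s (here refl) = ≤-<-trans z≤n (strict-head s)
strict-pos {_ ∷ _} s (there y∈) = strict-pos (strict-tail s) y∈

strict-0∉ : ∀ {xs} → Strict xs → 0 ∉ xs
strict-0∉ s 0∈ = <-irrefl refl (strict-pos s 0∈)

part-bound : ∀ {x xs} → Strict (x ∷ xs) → ∀ r → part xs r ≤ x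
part-bound {x} {xs} s r = go xs r (λ y∈ → <⇒≤ (strict-bound s y∈))
  where
  go : ∀ ys r → (∀ {y} → y ∈ ys → y ≤ x) → part ys r ≤ x
  go []       r             _ = z≤n
  go (y ∷ ys) zero          _ = z≤n
  go (y ∷ ys) (suc zero)    b = b (here refl)
  go (y ∷ ys) (suc (suc r)) b = go ys (suc r) (λ y∈ → b (there y∈))

-- the number of parts ≥ d, i.e. the number of cells of diagonal value d
diagLen : List ℕ → ℕ → ℕ
diagLen []       d = 0
diagLen (x ∷ xs) d with d ≤? x
... | yes _ = suc (diagLen xs d)
... | no _  = diagLen xs d

-- the indicator of d ≤ a: the contribution of a part a to diagLen _ d
ind : ℕ → ℕ → ℕ
ind d a with d ≤? a
... | yes _ = 1
... | no _  = 0

ind-yes : ∀ {d a} → d ≤ a → ind d a ≡ 1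
ind-yes {d} {a} d≤a with d ≤? a
... | yes _ = refl
... | no d≰a = ⊥-elim (d≰a d≤a)

ind-no : ∀ {d a} → a < d → ind d a ≡ 0
ind-no {d} {a} a<d with d ≤? a
... | yes d≤a = ⊥-elim (<⇒≱ a<d d≤a)
... | no _ = refl

diagLen-cons : ∀ x xs d → diagLen (x ∷ xs) d ≡ ind d x + diagLen xs d
diagLen-cons x xs d with d ≤? x
... | yes _ = refl
... | no _  = refl

diagLen-empty : ∀ xs d → (∀ {y} → y ∈ xs → y < d) → diagLen xs d ≡ 0
diagLen-empty []       d _ = refl
diagLen-empty (x ∷ xs) d small with d ≤? x
... | yes d≤x = ⊥-elim (<⇒≱ (small (here refl)) d≤x)
... | no _    = diagLen-empty xs d (λ y∈ → small (there y∈))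

diagLen-antitone : ∀ xs {d d'} → d ≤ d' → diagLen xs d' ≤ diagLen xs d
diagLen-antitone []       _ = z≤n
diagLen-antitone (x ∷ xs) {d} {d'} d≤d' with d ≤? x | d' ≤? x
... | yes _   | yes _    = s≤s (diagLen-antitone xs d≤d')
... | yes _   | no _     = m≤n⇒m≤1+n (diagLen-antitone xs d≤d')
... | no d≰x  | yes d'≤x = ⊥-elim (d≰x (≤-trans d≤d' d'≤x))
... | no _    | no _     = diagLen-antitone xs d≤d'

diagLen-step : ∀ xs d → Strict xs → diagLen xs d ≤ suc (diagLen xs (suc d))
diagLen-step []       d _ = z≤n
diagLen-step (x ∷ xs) d s with d ≤? x | suc d ≤? x
... | yes _   | yes _ = s≤s (diagLen-step xs d (strict-tail s))
... | yes d≤x | no d≮x with m≤n⇒m<n∨m≡n d≤x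
...   | inj₁ d<x  = ⊥-elim (d≮x d<x)
...   | inj₂ refl = s≤s (subst (_≤ diagLen xs (suc d)) (sym (diagLen-empty xs d (strict-bound s))) z≤n)
diagLen-step (x ∷ xs) d s | no d≰x | yes d<x = ⊥-elim (d≰x (<⇒≤ d<x))
diagLen-step (x ∷ xs) d s | no _   | no _    = diagLen-step xs d (strict-tail s)

diagLen-drop : ∀ xs {e} → e ∈ xs → diagLen xs (suc e) < diagLen xs e
diagLen-drop (x ∷ xs) {e} e∈ with e ≤? x | suc e ≤? x
diagLen-drop (x ∷ xs) (here refl) | yes _ | yes e<e = ⊥-elim (<-irrefl refl e<e)
diagLen-drop (x ∷ xs) (there e∈)  | yes _ | yes _   = s≤s (diagLen-drop xs e∈)
... | yes _   | no _    = s≤s (diagLen-antitone xs (n≤1+n _))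
... | no e≰x  | yes e<x = ⊥-elim (e≰x (<⇒≤ e<x))
diagLen-drop (x ∷ xs) (here refl) | no e≰e | no _ = ⊥-elim (e≰e ≤-refl)
diagLen-drop (x ∷ xs) (there e∈)  | no _   | no _ = diagLen-drop xs e∈

diagLen-drop⁻ : ∀ xs e → diagLen xs (suc e) < diagLen xs e → e ∈ xs
diagLen-drop⁻ (x ∷ xs) e drop with e ≤? x | suc e ≤? x
... | yes _   | yes _ = there (diagLen-drop⁻ xs e (≤-pred drop))
... | yes e≤x | no e≮x with m≤n⇒m<n∨m≡n e≤x
...   | inj₁ e<x = ⊥-elim (e≮x e<x)
...   | inj₂ e≡x = here e≡x
diagLen-drop⁻ (x ∷ xs) e drop | no e≰x | yes e<x = ⊥-elim (e≰x (<⇒≤ e<x))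
diagLen-drop⁻ (x ∷ xs) e drop | no _   | no _    = there (diagLen-drop⁻ xs e drop)

diagLen-pos : ∀ xs {e d} → e ∈ xs → d ≤ e → 1 ≤ diagLen xs d
diagLen-pos xs e∈ d≤e =
  ≤-trans (≤-<-trans z≤n (diagLen-drop xs e∈)) (diagLen-antitone xs d≤e)

part⇔diagLen : ∀ μ r e → Strict μ →
  suc e ≤ part μ (suc r) ⇔ suc r ≤ diagLen μ (suc e)
part⇔diagLen μ r e s = mk⇔ (to μ r s) (from μ r s)
  where
  to : ∀ μ r → Strict μ → suc e ≤ part μ (suc r) → suc r ≤ diagLen μ (suc e)
  to (x ∷ xs) r s h with suc e ≤? x
  to (x ∷ xs) zero    s h | yes _ = s≤s z≤n
  to (x ∷ xs) (suc r) s h | yes _ = s≤s (to xs r (strict-tail s) h)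
  to (x ∷ xs) zero    s h | no e≮x = ⊥-elim (e≮x h)
  to (x ∷ xs) (suc r) s h | no e≮x = ⊥-elim (e≮x (≤-trans h (part-bound s (suc r))))
  from : ∀ μ r → Strict μ → suc r ≤ diagLen μ (suc e) → suc e ≤ part μ (suc r)
  from (x ∷ xs) r s h with suc e ≤? x
  from (x ∷ xs) zero    s h | yes e<x = e<x
  from (x ∷ xs) (suc r) s h | yes _   = from xs r (strict-tail s) (≤-pred h)
  from (x ∷ xs) r s h | no e≮x = ⊥-elim (<⇒≱ h (≤-trans (≤-reflexive empty) z≤n))
    where
    empty : diagLen xs (suc e) ≡ 0
    empty = diagLen-empty xs (suc e) (λ y∈ → <-≤-trans (strict-bound s y∈) (m≤n⇒m≤1+n (≮⇒≥ e≮x)))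

InDiag : List ℕ → Cell → Set
InDiag μ (c , r) = 1 ≤ r × r ≤ c × r ≤ diagLen μ (diag (c , r))

below⇔diag≤ : ∀ {r c P} → r ≤ c → c < r + P ⇔ suc (c ∸ r) ≤ P
below⇔diag≤ {r} {c} {P} r≤c = mk⇔
  (λ h → +-cancelˡ-< r (c ∸ r) P (subst (_< r + P) (sym (m+[n∸m]≡n r≤c)) h))
  (λ h → subst (_< r + P) (m+[n∸m]≡n r≤c) (+-monoʳ-< r h))

InSD⇔InDiag : ∀ μ x → Strict μ → InSD μ x ⇔ InDiag μ x
InSD⇔InDiag μ (c , suc r) s = mk⇔
  (λ (1≤r , r≤c , h) → 1≤r , r≤c ,
     Equivalence.to (part⇔diagLen μ r (c ∸ suc r) s) (Equivalence.to (below⇔diag≤ r≤c) h))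
  (λ (1≤r , r≤c , h) → 1≤r , r≤c ,
     Equivalence.from (below⇔diag≤ r≤c) (Equivalence.from (part⇔diagLen μ r (c ∸ suc r) s) h))
InSD⇔InDiag μ (c , zero) s = mk⇔ (λ ()) (λ ())

InSD-mono : ∀ ν μ → Strict ν → Strict μ →
  (∀ e → diagLen ν (suc e) ≤ diagLen μ (suc e)) → ∀ x → InSD ν x → InSD μ x
InSD-mono ν μ sν sμ le (c , r) x∈ν with Equivalence.to (InSD⇔InDiag ν (c , r) sν) x∈ν
... | 1≤r , r≤c , h = Equivalence.from (InSD⇔InDiag μ (c , r) sμ) (1≤r , r≤c , ≤-trans h (le (c ∸ r)))

InSD-cong : ∀ ν μ → Strict ν → Strict μ →
  (∀ e → diagLen ν (suc e) ≡ diagLen μ (suc e)) → ∀ x → InSD ν x ⇔ InSD μ x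
InSD-cong ν μ sν sμ eq x = mk⇔
  (InSD-mono ν μ sν sμ (λ e → ≤-reflexive (eq e)) x)
  (InSD-mono μ ν sμ sν (λ e → ≤-reflexive (sym (eq e))) x)

InSD? : ∀ μ x → Dec (InSD μ x)
InSD? μ (c , r) = (1 ≤? r) ×-dec ((r ≤? c) ×-dec (suc c ≤? r + part μ r))

removePart-here : ∀ a xs → removePart a (a ∷ xs) ≡ xs
removePart-here a xs with a ≡ᵇ a | ≡⇒≡ᵇ a a refl
... | true  | _ = refl
... | false | ()

removePart-there : ∀ a x xs → x ≢ a → removePart a (x ∷ xs) ≡ x ∷ removePart a xs
removePart-there a x xs x≢a with x ≡ᵇ a | ≡ᵇ⇒≡ x a
... | true  | x≡a = ⊥-elim (x≢a (x≡a tt))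
... | false | _   = refl

diagLen-removePart : ∀ μ a d → a ∈ μ → diagLen μ d ≡ ind d a + diagLen (removePart a μ) d
diagLen-removePart (x ∷ xs) a d a∈ with x ≟ a
... | yes refl rewrite removePart-here x xs = diagLen-cons x xs d
... | no x≢a rewrite removePart-there a x xs x≢a with a∈
...   | here a≡x = ⊥-elim (x≢a (sym a≡x))
...   | there a∈xs = begin
  diagLen (x ∷ xs) d                              ≡⟨ diagLen-cons x xs d ⟩
  ind d x + diagLen xs d                          ≡⟨ cong (ind d x +_) (diagLen-removePart xs a d a∈xs) ⟩
  ind d x + (ind d a + diagLen (removePart a xs) d) ≡⟨ x∙yz≈y∙xz (ind d x) (ind d a) _ ⟩
  ind d a + (ind d x + diagLen (removePart a xs) d) ≡⟨ cong (ind d a +_) (sym (diagLen-cons x _ d)) ⟩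
  ind d a + diagLen (x ∷ removePart a xs) d       ∎
  where open ≡-Reasoning

removePart-⊆ : ∀ μ a {y} → y ∈ removePart a μ → y ∈ μ
removePart-⊆ (x ∷ xs) a y∈ with x ≟ a
... | yes refl rewrite removePart-here x xs = there y∈
... | no x≢a rewrite removePart-there a x xs x≢a with y∈
...   | here y≡x  = here y≡x
...   | there y∈' = there (removePart-⊆ xs a y∈')

removePart-keeps : ∀ μ a {y} → y ∈ μ → y ≢ a → y ∈ removePart a μ
removePart-keeps (x ∷ xs) a y∈ y≢a with x ≟ a
removePart-keeps (x ∷ xs) a (here refl) y≢a | yes refl = ⊥-elim (y≢a refl)
removePart-keeps (x ∷ xs) a (there y∈)  y≢a | yes refl rewrite removePart-here x xs = y∈
... | no x≢a rewrite removePart-there a x xs x≢a with y∈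
...   | here y≡x  = here y≡x
...   | there y∈' = there (removePart-keeps xs a y∈' y≢a)

removePart-strict : ∀ μ a → Strict μ → Strict (removePart a μ)
removePart-strict []       a s = tt
removePart-strict (x ∷ xs) a s with x ≟ a
... | yes refl rewrite removePart-here x xs = strict-tail s
... | no x≢a rewrite removePart-there a x xs x≢a =
  strict-cons (≤-<-trans (hd-removePart xs (strict-tail s)) (strict-head s))
              (removePart-strict xs a (strict-tail s))
  where
  hd-removePart : ∀ ys → Strict ys → hd (removePart a ys) ≤ hd ys
  hd-removePart []       _ = z≤n
  hd-removePart (y ∷ ys) s with y ≟ a
  ... | yes refl rewrite removePart-here y ys = <⇒≤ (strict-head s)
  ... | no y≢a   rewrite removePart-there a y ys y≢a = ≤-refl

insertPart-front : ∀ n x xs → x < suc n → insertPart (suc n) (x ∷ xs) ≡ suc n ∷ x ∷ xs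
insertPart-front n x xs x<n with x <ᵇ suc n | <⇒<ᵇ x<n
... | true  | _ = refl
... | false | ()

insertPart-later : ∀ n x xs → ¬ x < suc n → insertPart (suc n) (x ∷ xs) ≡ x ∷ insertPart (suc n) xs
insertPart-later n x xs x≮n with x <ᵇ suc n | <ᵇ⇒< x (suc n)
... | true  | x<n = ⊥-elim (x≮n (x<n tt))
... | false | _   = refl

diagLen-insertPart : ∀ n μ d → 1 ≤ d → diagLen (insertPart n μ) d ≡ ind d n + diagLen μ d
diagLen-insertPart zero    μ d 1≤d = cong (_+ diagLen μ d) (sym (ind-no 1≤d))
diagLen-insertPart (suc n) [] d _ = diagLen-cons (suc n) [] d
diagLen-insertPart (suc n) (x ∷ xs) d 1≤d with x <? suc n
... | yes x<n rewrite insertPart-front n x xs x<n = diagLen-cons (suc n) (x ∷ xs) d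
... | no x≮n  rewrite insertPart-later n x xs x≮n = begin
  diagLen (x ∷ insertPart (suc n) xs) d          ≡⟨ diagLen-cons x _ d ⟩
  ind d x + diagLen (insertPart (suc n) xs) d    ≡⟨ cong (ind d x +_) (diagLen-insertPart (suc n) xs d 1≤d) ⟩
  ind d x + (ind d (suc n) + diagLen xs d)       ≡⟨ x∙yz≈y∙xz (ind d x) (ind d (suc n)) _ ⟩
  ind d (suc n) + (ind d x + diagLen xs d)       ≡⟨ cong (ind d (suc n) +_) (sym (diagLen-cons x xs d)) ⟩
  ind d (suc n) + diagLen (x ∷ xs) d             ∎
  where open ≡-Reasoning

insertPart-strict : ∀ n μ → Strict μ → n ∉ μ → Strict (insertPart n μ)
insertPart-strict zero    μ s _ = s
insertPart-strict (suc n) [] s _ = s≤s z≤n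
insertPart-strict (suc n) (x ∷ xs) s n∉ with x <? suc n
... | yes x<n rewrite insertPart-front n x xs x<n = x<n , s
... | no x≮n  rewrite insertPart-later n x xs x≮n =
  strict-cons head< (insertPart-strict (suc n) xs (strict-tail s) (λ n∈ → n∉ (there n∈)))
  where
  n<x : suc n < x
  n<x = ≤∧≢⇒< (≮⇒≥ x≮n) (λ n≡x → n∉ (here n≡x))
  head< : hd (insertPart (suc n) xs) < x
  head< = go xs (strict-head s)
    where
    go : ∀ ys → hd ys < x → hd (insertPart (suc n) ys) < x
    go []       _ = n<x
    go (y ∷ ys) y<x with y <? suc n
    ... | yes y<n rewrite insertPart-front n y ys y<n = n<x
    ... | no y≮n  rewrite insertPart-later n y ys y≮n = y<x

-- ν arises from μ by replacing the part hi by lo, as far as diagonal lengths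
-- are concerned: μ with lo added and ν with hi added have equal diagonals
Replaces : ℕ → ℕ → List ℕ → List ℕ → Set
Replaces hi lo μ ν = ∀ d → 1 ≤ d → ind d hi + diagLen ν d ≡ ind d lo + diagLen μ d

replacePart-replaces : ∀ μ hi lo → hi ∈ μ → Replaces hi lo μ (replacePart hi lo μ)
replacePart-replaces μ hi lo hi∈ d 1≤d = begin
  ind d hi + diagLen (insertPart lo (removePart hi μ)) d    ≡⟨ cong (ind d hi +_) (diagLen-insertPart lo _ d 1≤d) ⟩
  ind d hi + (ind d lo + diagLen (removePart hi μ) d)        ≡⟨ x∙yz≈y∙xz (ind d hi) (ind d lo) _ ⟩
  ind d lo + (ind d hi + diagLen (removePart hi μ) d)        ≡⟨ cong (ind d lo +_) (sym (diagLen-removePart μ hi d hi∈)) ⟩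
  ind d lo + diagLen μ d                                    ∎
  where open ≡-Reasoning

replaces-inside : ∀ {hi lo μ ν} → Replaces hi lo μ ν → ∀ d → lo < d → d ≤ hi → diagLen μ d ≡ suc (diagLen ν d)
replaces-inside {hi} {lo} {μ} {ν} rep d lo<d d≤hi = sym (begin
  suc (diagLen ν d)          ≡⟨ cong (_+ diagLen ν d) (sym (ind-yes d≤hi)) ⟩
  ind d hi + diagLen ν d     ≡⟨ rep d (≤-trans (s≤s z≤n) lo<d) ⟩
  ind d lo + diagLen μ d     ≡⟨ cong (_+ diagLen μ d) (ind-no lo<d) ⟩
  diagLen μ d                ∎)
  where open ≡-Reasoning

replaces-outside : ∀ {hi lo μ ν} → lo < hi → Replaces hi lo μ ν → ∀ d → 1 ≤ d → ¬ (lo < d × d ≤ hi) →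
  diagLen μ d ≡ diagLen ν d
replaces-outside {hi} {lo} {μ} {ν} lo<hi rep d 1≤d outside with lo <? d
... | no lo≮d = suc-injective (begin
  suc (diagLen μ d)          ≡⟨ cong (_+ diagLen μ d) (sym (ind-yes (≮⇒≥ lo≮d))) ⟩
  ind d lo + diagLen μ d     ≡⟨ sym (rep d 1≤d) ⟩
  ind d hi + diagLen ν d     ≡⟨ cong (_+ diagLen ν d) (ind-yes (≤-trans (≮⇒≥ lo≮d) (<⇒≤ lo<hi))) ⟩
  suc (diagLen ν d)          ∎)
  where open ≡-Reasoning
... | yes lo<d = begin
  diagLen μ d                ≡⟨ cong (_+ diagLen μ d) (sym (ind-no lo<d)) ⟩
  ind d lo + diagLen μ d     ≡⟨ sym (rep d 1≤d) ⟩
  ind d hi + diagLen ν d     ≡⟨ cong (_+ diagLen ν d) (ind-no (≰⇒> (λ d≤hi → outside (lo<d , d≤hi)))) ⟩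
  diagLen ν d                ∎
  where open ≡-Reasoning

replaces-from-diagonals : ∀ {hi lo μ ν} → lo < hi →
  (∀ d → lo < d → d ≤ hi → diagLen μ d ≡ suc (diagLen ν d)) →
  (∀ d → 1 ≤ d → ¬ (lo < d × d ≤ hi) → diagLen μ d ≡ diagLen ν d) →
  Replaces hi lo μ ν
replaces-from-diagonals {hi} {lo} lo<hi inside outside d 1≤d with lo <? d | hi <? d
... | no lo≮d | _ rewrite ind-yes (≮⇒≥ lo≮d) | ind-yes (≤-trans (≮⇒≥ lo≮d) (<⇒≤ lo<hi)) =
  cong suc (sym (outside d 1≤d (λ (lo<d , _) → lo≮d lo<d)))
... | yes lo<d | no hi≮d rewrite ind-no lo<d | ind-yes (≮⇒≥ hi≮d) =
  sym (inside d lo<d (≮⇒≥ hi≮d))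
... | yes lo<d | yes hi<d rewrite ind-no lo<d | ind-no hi<d =
  sym (outside d 1≤d (λ (_ , d≤hi) → <⇒≱ hi<d d≤hi))

replaces-unique : ∀ {hi lo μ ν ν'} → Replaces hi lo μ ν → Replaces hi lo μ ν' →
  ∀ e → diagLen ν (suc e) ≡ diagLen ν' (suc e)
replaces-unique {hi} rep rep' e = +-cancelˡ-≡ (ind (suc e) hi) _ _ (trans (rep (suc e) z<s) (sym (rep' (suc e) z<s)))

Valid : Cell → Set
Valid (c , r) = 1 ≤ r × r ≤ c

InSD⇒Valid : ∀ μ x → InSD μ x → Valid x
InSD⇒Valid μ (c , r) (1≤r , r≤c , _) = 1≤r , r≤c

-- the cell in row r on the diagonal of value e + 1
cellOn : ℕ → ℕ → Cell
cellOn e r = (r + e , r)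

diag-cellOn : ∀ e r → diag (cellOn e r) ≡ suc e
diag-cellOn e r = cong suc (m+n∸m≡n r e)

diag-row-injective : ∀ x y → Valid x → Valid y → diag x ≡ diag y → proj₂ x ≡ proj₂ y → x ≡ y
diag-row-injective (c , r) (c' , .r) (_ , r≤c) (_ , r≤c') eq refl = cong (_, r) (begin
  c                ≡⟨ sym (m+[n∸m]≡n r≤c) ⟩
  r + (c ∸ r)      ≡⟨ cong (r +_) (suc-injective eq) ⟩
  r + (c' ∸ r)     ≡⟨ m+[n∸m]≡n r≤c' ⟩
  c'               ∎)
  where open ≡-Reasoning

Adj-diag : ∀ x y → Valid x → Valid y → Adj x y → diag y ≡ suc (diag x) ⊎ diag x ≡ suc (diag y)
Adj-diag (c , r) (.c , .(suc r)) _ (_ , r<c) (inj₁ (refl , inj₁ refl)) = inj₂ (cong suc (+-∸-assoc 1 r<c))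
Adj-diag (c , .(suc r)) (.c , r) (_ , r<c) _ (inj₁ (refl , inj₂ refl)) = inj₁ (cong suc (+-∸-assoc 1 r<c))
Adj-diag (c , r) (.(suc c) , .r) (_ , r≤c) _ (inj₂ (refl , inj₁ refl)) = inj₁ (cong suc (+-∸-assoc 1 r≤c))
Adj-diag (.(suc c) , r) (c , .r) _ (_ , r≤c) (inj₂ (refl , inj₂ refl)) = inj₂ (cong suc (+-∸-assoc 1 r≤c))

Adj-sym : ∀ x y → Adj x y → Adj y x
Adj-sym x y (inj₁ (eq , inj₁ up))    = inj₁ (sym eq , inj₂ up)
Adj-sym x y (inj₁ (eq , inj₂ down))  = inj₁ (sym eq , inj₁ down)
Adj-sym x y (inj₂ (eq , inj₁ right)) = inj₂ (sym eq , inj₂ right)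
Adj-sym x y (inj₂ (eq , inj₂ left))  = inj₂ (sym eq , inj₁ left)

AllValid : List Cell → Set
AllValid R = ∀ y → y ∈ R → Valid y

path-meets-diagonals : ∀ {R x z} → Path R x z → x ∈ R → AllValid R →
  ∀ d → diag x ≤ d → d ≤ diag z → Σ Cell λ y → y ∈ R × diag y ≡ d
path-meets-diagonals {x = x} stop x∈ _ d x≤d d≤z = x , x∈ , ≤-antisym x≤d d≤z
path-meets-diagonals {x = x} (step {y = y} adj y∈ path) x∈ valid d x≤d d≤z with d ≟ diag x
... | yes d≡x = x , x∈ , sym d≡x
... | no d≢x = path-meets-diagonals path y∈ valid d y≤d d≤z
  where
  x<d : diag x < d
  x<d = ≤∧≢⇒< x≤d (λ x≡d → d≢x (sym x≡d))
  y≤d : diag y ≤ d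
  y≤d with Adj-diag x y (valid x x∈) (valid y y∈) adj
  ... | inj₁ y≡x+1 = subst (_≤ d) (sym y≡x+1) x<d
  ... | inj₂ x≡y+1 = <⇒≤ (subst (_≤ d) x≡y+1 (<⇒≤ x<d))

path-snoc : ∀ {R x y z} → Path R x y → Adj y z → z ∈ R → Path R x z
path-snoc stop             adj z∈ = step adj z∈ stop
path-snoc (step a y∈ path) adj z∈ = step a y∈ (path-snoc path adj z∈)

path-reverse : ∀ {R x z} → x ∈ R → Path R x z → Path R z x
path-reverse x∈ stop               = stop
path-reverse x∈ (step adj y∈ path) = path-snoc (path-reverse y∈ path) (Adj-sym _ _ adj) x∈

module _ {A : Set} (_≟ₐ_ : DecidableEquality A) where

  delete : A → List A → List A
  delete x [] = []
  delete x (y ∷ ys) with y ≟ₐ x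
  ... | yes _ = ys
  ... | no _  = y ∷ delete x ys

  length-delete : ∀ x ys → x ∈ ys → length ys ≡ suc (length (delete x ys))
  length-delete x (y ∷ ys) x∈ with y ≟ₐ x
  ... | yes _ = refl
  length-delete x (y ∷ ys) (here x≡y)  | no y≢x = ⊥-elim (y≢x (sym x≡y))
  length-delete x (y ∷ ys) (there x∈) | no _   = cong suc (length-delete x ys x∈)

  ∈-delete : ∀ x ys {z} → z ∈ ys → z ≢ x → z ∈ delete x ys
  ∈-delete x (y ∷ ys) z∈ z≢x with y ≟ₐ x
  ∈-delete x (y ∷ ys) (here refl) z≢x | yes y≡x = ⊥-elim (z≢x y≡x)
  ∈-delete x (y ∷ ys) (there z∈)  z≢x | yes _   = z∈
  ∈-delete x (y ∷ ys) (here z≡y)  z≢x | no _    = here z≡y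
  ∈-delete x (y ∷ ys) (there z∈)  z≢x | no _    = there (∈-delete x ys z∈ z≢x)

  unique-length≤ : ∀ xs ys → Unique xs → (∀ {x} → x ∈ xs → x ∈ ys) → length xs ≤ length ys
  unique-length≤ []       ys _ _ = z≤n
  unique-length≤ (x ∷ xs) ys (x∉xs ∷ u) ⊆ys =
    subst (suc (length xs) ≤_) (sym (length-delete x ys (⊆ys (here refl))))
      (s≤s (unique-length≤ xs (delete x ys) u
        (λ z∈ → ∈-delete x ys (⊆ys (there z∈)) (λ z≡x → All.lookup x∉xs z∈ (sym z≡x)))))

unique-map-injective : ∀ {A B : Set} (f : A → B) R {x y} → Unique (map f R) →
  x ∈ R → y ∈ R → f x ≡ f y → x ≡ y
unique-map-injective f (z ∷ zs) _ (here refl) (here refl) _ = refl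
unique-map-injective f (z ∷ zs) (fz∉ ∷ _) (here refl) (there y∈) eq = ⊥-elim (All.lookup fz∉ (∈-map⁺ f y∈) eq)
unique-map-injective f (z ∷ zs) (fz∉ ∷ _) (there x∈) (here refl) eq = ⊥-elim (All.lookup fz∉ (∈-map⁺ f x∈) (sym eq))
unique-map-injective f (z ∷ zs) (_ ∷ u) (there x∈) (there y∈) eq = unique-map-injective f zs u x∈ y∈ eq

interval : ℕ → ℕ → List ℕ
interval lo = applyUpTo (λ i → suc (lo + i))

∈-interval⁻ : ∀ lo n {x} → x ∈ interval lo n → lo < x × x ≤ lo + n
∈-interval⁻ lo n x∈ with ∈-applyUpTo⁻ (λ i → suc (lo + i)) x∈
... | i , i<n , refl = s≤s (m≤m+n lo i) , subst (_≤ lo + n) (+-suc lo i) (+-monoʳ-≤ lo i<n)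

∈-interval⁺ : ∀ lo n {x} → lo < x → x ≤ lo + n → x ∈ interval lo n
∈-interval⁺ lo n {suc x} (s≤s lo≤x) x<lo+n =
  subst (_∈ interval lo n) (cong suc (m+[n∸m]≡n lo≤x))
    (∈-applyUpTo⁺ (λ i → suc (lo + i)) (Equivalence.to (below⇔diag≤ lo≤x) x<lo+n))

interval-unique : ∀ lo n → Unique (interval lo n)
interval-unique lo n =
  applyUpTo⁺₁ (λ i → suc (lo + i)) n (λ i<j _ eq → <⇒≢ i<j (+-cancelˡ-≡ lo _ _ (suc-injective eq)))

interval-length : ∀ xs lo hi → lo ≤ hi → Unique xs →
  (∀ {x} → x ∈ xs → lo < x × x ≤ hi) → (∀ x → lo < x → x ≤ hi → x ∈ xs) →
  length xs ≡ hi ∸ lo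
interval-length xs lo hi lo≤hi u within onto = ≤-antisym
  (subst (length xs ≤_) (length-applyUpTo _ n)
    (unique-length≤ _≟_ xs (interval lo n) u
      (λ {x} x∈ → let (lo<x , x≤hi) = within x∈ in ∈-interval⁺ lo n lo<x (subst (x ≤_) (sym lo+n≡hi) x≤hi))))
  (subst (_≤ length xs) (length-applyUpTo _ n)
    (unique-length≤ _≟_ (interval lo n) xs (interval-unique lo n)
      (λ {x} x∈ → let (lo<x , x≤lo+n) = ∈-interval⁻ lo n x∈ in onto x lo<x (subst (x ≤_) lo+n≡hi x≤lo+n))))
  where
  n = hi ∸ lo
  lo+n≡hi : lo + n ≡ hi
  lo+n≡hi = m+[n∸m]≡n lo≤hi

record DiagonalInterval (R : List Cell) : Set where
  field
    lo hi   : ℕ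
    lo<hi   : lo < hi
    length≡ : length R ≡ hi ∸ lo
    within  : ∀ {x} → x ∈ R → lo < diag x × diag x ≤ hi
    onto    : ∀ d → lo < d → d ≤ hi → Σ Cell λ x → x ∈ R × diag x ≡ d

  head-diag : ∀ {h} → IsHead R h → diag h ≡ hi
  head-diag {h} (h∈ , h-max) with onto hi lo<hi ≤-refl
  ... | x , x∈ , x≡hi = ≤-antisym (proj₂ (within h∈)) (subst (_≤ diag h) x≡hi (h-max x x∈))

  tail-diag : ∀ {t} → IsTail R t → diag t ≡ suc lo
  tail-diag {t} (t∈ , t-min) with onto (suc lo) ≤-refl lo<hi
  ... | x , x∈ , x≡lo+1 = ≤-antisym (subst (diag t ≤_) x≡lo+1 (t-min x x∈)) (proj₁ (within t∈))

ribbon-interval : ∀ R → R ≢ [] → EdgeConnected R → Unique (map diag R) → AllValid R →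
  DiagonalInterval R
ribbon-interval []       R≢[] _ _ _ = ⊥-elim (R≢[] refl)
ribbon-interval (x ∷ xs) _ connected u valid = record
  { lo = pred (diag t) ; hi = diag h ; lo<hi = lo<hi ; length≡ = length≡
  ; within = λ y∈ → lo<y y∈ , h-max y∈ ; onto = onto }
  where
  R = x ∷ xs
  t = argmin diag x xs
  h = argmax diag x xs
  extremum∈ : ∀ {m} → m ≡ x ⊎ m ∈ xs → m ∈ R
  extremum∈ (inj₁ m≡x) = here m≡x
  extremum∈ (inj₂ m∈) = there m∈
  t∈ : t ∈ R
  t∈ = extremum∈ (argmin-sel diag x xs)
  h∈ : h ∈ R
  h∈ = extremum∈ (argmax-sel diag x xs)
  t-min : ∀ {y} → y ∈ R → diag t ≤ diag y
  t-min (here refl) = f[argmin]≤f[⊤] {f = diag} x xs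
  t-min (there y∈)  = All.lookup (f[argmin]≤f[xs] {f = diag} x xs) y∈
  h-max : ∀ {y} → y ∈ R → diag y ≤ diag h
  h-max (here refl) = f[⊥]≤f[argmax] {f = diag} x xs
  h-max (there y∈)  = All.lookup (f[xs]≤f[argmax] {f = diag} x xs) y∈
  lo<y : ∀ {y} → y ∈ R → pred (diag t) < diag y
  lo<y = t-min
  lo<hi : pred (diag t) < diag h
  lo<hi = lo<y h∈
  onto : ∀ d → pred (diag t) < d → d ≤ diag h → Σ Cell λ y → y ∈ R × diag y ≡ d
  onto d t≤d d≤h = path-meets-diagonals (connected t h t∈ h∈) t∈ valid d t≤d d≤h
  length≡ : length R ≡ diag h ∸ pred (diag t)
  length≡ = trans (sym (length-map diag R))
    (interval-length (map diag R) _ _ (<⇒≤ lo<hi) u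
      (λ d∈ → let (y , y∈ , d≡y) = ∈-map⁻ diag d∈ in subst (λ d → _ < d × d ≤ _) (sym d≡y) (lo<y y∈ , h-max y∈))
      (λ d lo<d d≤h → let (y , y∈ , y≡d) = onto d lo<d d≤h in subst (_∈ map diag R) y≡d (∈-map⁺ diag y∈)))

singleRibbon-interval : ∀ μ R → (∀ x → x ∈ R → InSD μ x) → SingleRibbon R → DiagonalInterval R
singleRibbon-interval μ R R⊆μ (R≢[] , connected , _ , u) =
  ribbon-interval R R≢[] connected u (λ y y∈ → InSD⇒Valid μ y (R⊆μ y y∈))

InSD-cellOn : ∀ μ → Strict μ → ∀ e r → 1 ≤ r → InSD μ (cellOn e r) ⇔ r ≤ diagLen μ (suc e)
InSD-cellOn μ s e r 1≤r = mk⇔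
  (λ x∈ → subst (λ d → r ≤ diagLen μ d) (diag-cellOn e r)
            (proj₂ (proj₂ (Equivalence.to (InSD⇔InDiag μ (cellOn e r) s) x∈))))
  (λ r≤ → Equivalence.from (InSD⇔InDiag μ (cellOn e r) s)
            (1≤r , m≤m+n r e , subst (λ d → r ≤ diagLen μ d) (sym (diag-cellOn e r)) r≤))

diagLen-mono : ∀ ν μ → Strict ν → Strict μ → (∀ x → InSD ν x → InSD μ x) →
  ∀ e → diagLen ν (suc e) ≤ diagLen μ (suc e)
diagLen-mono ν μ sν sμ ν⊆μ e with diagLen ν (suc e) in len
... | zero  = z≤n
... | suc r = Equivalence.to (InSD-cellOn μ sμ e (suc r) z<s)
                (ν⊆μ _ (Equivalence.from (InSD-cellOn ν sν e (suc r) z<s) (≤-reflexive (sym len))))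

-- Removing a decidable set P of cells from the shifted diagram of μ leaves
-- the shifted diagram of ν.  On every diagonal the removed cells are then
-- exactly the rows above the top of ν.
module Removal (μ ν : List ℕ) (sμ : Strict μ) (sν : Strict ν) (P : Cell → Set)
               (P? : ∀ x → Dec (P x)) (P⊆μ : ∀ x → P x → InSD μ x)
               (rest : ∀ x → (InSD μ x × ¬ P x) ⇔ InSD ν x) where

  shorter : ∀ e → diagLen ν (suc e) ≤ diagLen μ (suc e)
  shorter = diagLen-mono ν μ sν sμ (λ x x∈ν → proj₁ (Equivalence.from (rest x) x∈ν))

  removed-above : ∀ e r → diagLen ν (suc e) < r → r ≤ diagLen μ (suc e) → P (cellOn e r)
  removed-above e r ν<r r≤μ with P? (cellOn e r)
  ... | yes removed = removed
  ... | no kept = ⊥-elim (<⇒≱ ν<r (Equivalence.to (InSD-cellOn ν sν e r 1≤r)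
                    (Equivalence.to (rest (cellOn e r)) (Equivalence.from (InSD-cellOn μ sμ e r 1≤r) r≤μ , kept))))
    where
    1≤r : 1 ≤ r
    1≤r = ≤-trans (s≤s z≤n) ν<r

  removed-rows : ∀ x → P x → Valid x × diagLen ν (diag x) < proj₂ x × proj₂ x ≤ diagLen μ (diag x)
  removed-rows (c , r) removed with Equivalence.to (InSD⇔InDiag μ (c , r) sμ) (P⊆μ (c , r) removed)
  ... | 1≤r , r≤c , r≤μ = (1≤r , r≤c) , ≰⇒> below-ν , r≤μ
    where
    below-ν : ¬ r ≤ diagLen ν (diag (c , r))
    below-ν r≤ν = proj₂ (Equivalence.from (rest (c , r))
                    (Equivalence.from (InSD⇔InDiag ν (c , r) sν) (1≤r , r≤c , r≤ν))) removed

  two-removed : ∀ x y → P x → P y → x ≢ y → diag x ≡ diag y →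
    suc (suc (diagLen ν (diag x))) ≤ diagLen μ (diag x)
  two-removed x y Px Py x≢y same with removed-rows x Px | removed-rows y Py
  ... | (vx , ν<x , x≤μ) | (vy , ν<y , y≤μ) with <-cmp (proj₂ x) (proj₂ y)
  ... | tri< x<y _ _ = ≤-trans (s≤s ν<x) (≤-trans x<y (subst (λ d → proj₂ y ≤ diagLen μ d) (sym same) y≤μ))
  ... | tri≈ _ x≈y _ = ⊥-elim (x≢y (diag-row-injective x y vx vy same x≈y))
  ... | tri> _ _ y<x = ≤-trans (s≤s (subst (λ d → diagLen ν d < proj₂ y) (sym same) ν<y)) (≤-trans y<x x≤μ)

  top-removed : ∀ e j → j + diagLen ν (suc e) < diagLen μ (suc e) → P (cellOn e (diagLen μ (suc e) ∸ j))
  top-removed e j lost = removed-above e _ below (m∸n≤m _ j)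
    where
    below : diagLen ν (suc e) < diagLen μ (suc e) ∸ j
    below = +-cancelˡ-< j _ _ (subst (j + diagLen ν (suc e) <_)
              (sym (m+[n∸m]≡n (≤-trans (m≤m+n j _) (<⇒≤ lost)))) lost)

remainder : ∀ μ P → Removable μ P → List ℕ
remainder μ P (_ , ν , _) = ν

remainder-strict : ∀ μ P (rm : Removable μ P) → Strict (remainder μ P rm)
remainder-strict μ P (_ , _ , sν , _) = sν

remainder-diagram : ∀ μ P (rm : Removable μ P) → ∀ x → (InSD μ x × ¬ P x) ⇔ InSD (remainder μ P rm) x
remainder-diagram μ P (_ , _ , _ , rest) = rest

same-complement : ∀ μ {P Q : Cell → Set} (D : Cell → Set) → (∀ x → Dec (Q x)) →
  (∀ x → P x → InSD μ x) → (∀ x → (InSD μ x × ¬ P x) ⇔ D x) → (∀ x → (InSD μ x × ¬ Q x) ⇔ D x) →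
  ∀ x → P x → Q x
same-complement μ D Q? P⊆μ restP restQ x Px with Q? x
... | yes Qx = Qx
... | no ¬Qx = ⊥-elim (proj₂ (Equivalence.from (restP x) (Equivalence.to (restQ x) (P⊆μ x Px , ¬Qx))) Px)

ribbon-one-per-diagonal : ∀ R → Unique (map diag R) → ∀ e {i j} → cellOn e i ∈ R → cellOn e j ∈ R → i ≡ j
ribbon-one-per-diagonal R u e {i} {j} i∈ j∈ =
  cong proj₂ (unique-map-injective diag R u i∈ j∈ (trans (diag-cellOn e i) (sym (diag-cellOn e j))))

rows-from-top-differ : ∀ t {i j} → i < j → j ≤ t → t ∸ i ≢ t ∸ j
rows-from-top-differ t i<j j≤t eq = <-irrefl (sym eq) (∸-monoʳ-< i<j j≤t)

-- Removing a single ribbon with head on diagonal K = m + k shortens exactly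
-- the diagonals m + 1, …, K by one; hence K ∈ λ, m ∉ λ and λ \ R is λ with
-- K replaced by m.

module RemovedSingle (p : List ℕ) (sp : Strict p) (k m : ℕ) (1≤k : 1 ≤ k)
                     (R : List Cell) (rs : RemovableSingle p k (m + k) R) where

  K : ℕ
  K = m + k

  m<K : m < K
  m<K = m<m+n m 1≤k

  ribbon : SingleRibbon R
  ribbon = proj₁ rs

  rm : Removable p (_∈ R)
  rm = proj₁ (proj₂ (proj₂ rs))

  R⊆p : ∀ x → x ∈ R → InSD p x
  R⊆p = proj₁ rm

  ν : List ℕ
  ν = remainder p (_∈ R) rm

  sν : Strict ν
  sν = remainder-strict p (_∈ R) rm

  open Removal p ν sp sν (_∈ R) (_∈? R) R⊆p (remainder-diagram p (_∈ R) rm)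
  open DiagonalInterval (singleRibbon-interval p R R⊆p ribbon)

  hi≡K : hi ≡ K
  hi≡K = let (h , head , h≡K) = proj₂ (proj₂ (proj₂ rs)) in trans (sym (head-diag head)) h≡K

  lo≡m : lo ≡ m
  lo≡m = +-cancelʳ-≡ k lo m (begin
    lo + k               ≡⟨ cong (lo +_) (trans (sym (proj₁ (proj₂ rs))) length≡) ⟩
    lo + (hi ∸ lo)       ≡⟨ m+[n∸m]≡n (<⇒≤ lo<hi) ⟩
    hi                   ≡⟨ hi≡K ⟩
    m + k                ∎)
    where open ≡-Reasoning

  lost-inside : ∀ d → m < d → d ≤ K → diagLen p d ≡ suc (diagLen ν d)
  lost-inside (suc e) m<d d≤K = ≤-antisym (≮⇒≥ at-most-one) at-least-one
    where
    at-least-one : diagLen ν (suc e) < diagLen p (suc e)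
    at-least-one with onto (suc e) (subst (_< suc e) (sym lo≡m) m<d) (subst (suc e ≤_) (sym hi≡K) d≤K)
    ... | x , x∈ , x≡d with removed-rows x x∈
    ...   | _ , ν<x , x≤p = subst (λ d → diagLen ν d < diagLen p d) x≡d (<-≤-trans ν<x x≤p)
    at-most-one : ¬ suc (suc (diagLen ν (suc e))) ≤ diagLen p (suc e)
    at-most-one two = rows-from-top-differ (diagLen p (suc e)) z<s (≤-trans (s≤s z≤n) two)
      (ribbon-one-per-diagonal R (proj₂ (proj₂ (proj₂ ribbon))) e
        (top-removed e 0 (<-trans (n<1+n _) two)) (top-removed e 1 two))

  lost-outside : ∀ d → 1 ≤ d → ¬ (m < d × d ≤ K) → diagLen p d ≡ diagLen ν d
  lost-outside (suc e) _ outside = ≤-antisym (≮⇒≥ none-removed) (shorter e)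
    where
    none-removed : ¬ diagLen ν (suc e) < diagLen p (suc e)
    none-removed lost with within (top-removed e 0 lost)
    ... | lo<d , d≤hi = outside
      ( subst₂ _<_ lo≡m (diag-cellOn e (diagLen p (suc e) ∸ 0)) lo<d
      , subst₂ _≤_ (diag-cellOn e (diagLen p (suc e) ∸ 0)) hi≡K d≤hi)

  part-K : K ∈ p
  part-K = diagLen-drop⁻ p K (begin-strict
    diagLen p (suc K)  ≡⟨ lost-outside (suc K) z<s (λ (_ , K<K) → 1+n≰n K<K) ⟩
    diagLen ν (suc K)  ≤⟨ diagLen-antitone ν (n≤1+n K) ⟩
    diagLen ν K        <⟨ n<1+n _ ⟩
    suc (diagLen ν K)  ≡⟨ sym (lost-inside K m<K ≤-refl) ⟩
    diagLen p K        ∎)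
    where open ≤-Reasoning

  no-part-m : m ∉ p
  no-part-m m∈p = <⇒≱ (diagLen-drop p m∈p) (begin
    diagLen p m              ≡⟨ lost-outside m (strict-pos sp m∈p) (λ (m<m , _) → <-irrefl refl m<m) ⟩
    diagLen ν m              ≤⟨ diagLen-step ν m sν ⟩
    suc (diagLen ν (suc m))  ≡⟨ sym (lost-inside (suc m) ≤-refl m<K) ⟩
    diagLen p (suc m)        ∎)
    where open ≤-Reasoning

  parts : K ∈ p × m ∉ p
  parts = part-K , no-part-m

  replaced-strict : Strict (replacePart K m p)
  replaced-strict = insertPart-strict m _ (removePart-strict p K sp) (λ m∈ → no-part-m (removePart-⊆ p K m∈))

  remains-replaced : ∀ x → (InSD p x × x ∉ R) ⇔ InSD (replacePart K m p) x
  remains-replaced x =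
    InSD-cong ν (replacePart K m p) sν replaced-strict
      (replaces-unique {μ = p} {ν = ν} {ν' = replacePart K m p} replaces (replacePart-replaces p K m part-K)) x
    ⇔-∘ remainder-diagram p (_∈ R) rm x
    where
    replaces : Replaces K m p ν
    replaces = replaces-from-diagonals {μ = p} {ν = ν} m<K lost-inside lost-outside

topCell : List ℕ → ℕ → Cell
topCell μ e = cellOn e (diagLen μ (suc e))

diag-topCell : ∀ μ e → diag (topCell μ e) ≡ suc e
diag-topCell μ e = diag-cellOn e (diagLen μ (suc e))

topCell-adjacent : ∀ μ e → Strict μ → Adj (topCell μ e) (topCell μ (suc e))
topCell-adjacent μ e s with m≤n⇒m<n∨m≡n (diagLen-step μ (suc e) s)
... | inj₂ one-shorter = inj₁ (trans (cong (_+ e) one-shorter) (sym (+-suc _ e)) , inj₂ (sym one-shorter))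
... | inj₁ not-shorter with m≤n⇒m<n∨m≡n (diagLen-antitone μ {suc e} {suc (suc e)} (n≤1+n _))
...   | inj₂ same-length = inj₂ (sym same-length , inj₁ (trans (cong suc (cong (_+ e) (sym same-length))) (sym (+-suc _ e))))
...   | inj₁ shorter = ⊥-elim (<⇒≱ not-shorter shorter)

map-applyUpTo : ∀ {A B : Set} (g : A → B) (f : ℕ → A) n → map g (applyUpTo f n) ≡ applyUpTo (λ i → g (f i)) n
map-applyUpTo g f zero    = refl
map-applyUpTo g f (suc n) = cong (g (f 0) ∷_) (map-applyUpTo g (λ i → f (suc i)) n)

module TopRibbon (μ : List ℕ) (sμ : Strict μ) (lo hi : ℕ) (lo<hi : lo < hi)
                 (hi∈μ : hi ∈ μ) (lo∉μ : lo ∉ μ) where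

  n : ℕ
  n = hi ∸ lo

  lo+n≡hi : lo + n ≡ hi
  lo+n≡hi = m+[n∸m]≡n (<⇒≤ lo<hi)

  R : List Cell
  R = applyUpTo (λ i → topCell μ (lo + i)) n

  ν : List ℕ
  ν = replacePart hi lo μ

  sν : Strict ν
  sν = insertPart-strict lo _ (removePart-strict μ hi sμ) (λ lo∈ → lo∉μ (removePart-⊆ μ hi lo∈))

  replaces : Replaces hi lo μ ν
  replaces = replacePart-replaces μ hi lo hi∈μ

  lost-inside : ∀ e → lo ≤ e → e < hi → diagLen μ (suc e) ≡ suc (diagLen ν (suc e))
  lost-inside e lo≤e e<hi = replaces-inside {μ = μ} {ν = ν} replaces (suc e) (s≤s lo≤e) e<hi

  lost-outside : ∀ e → ¬ (lo ≤ e × e < hi) → diagLen μ (suc e) ≡ diagLen ν (suc e)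
  lost-outside e outside =
    replaces-outside {μ = μ} {ν = ν} lo<hi replaces (suc e) z<s (λ (lo<d , e<hi) → outside (≤-pred lo<d , e<hi))

  ν⊆μ : ∀ x → InSD ν x → InSD μ x
  ν⊆μ = InSD-mono ν μ sν sμ shorter
    where
    shorter : ∀ e → diagLen ν (suc e) ≤ diagLen μ (suc e)
    shorter e with lo ≤? e | e <? hi
    ... | yes lo≤e | yes e<hi = subst (diagLen ν (suc e) ≤_) (sym (lost-inside e lo≤e e<hi)) (n≤1+n _)
    ... | no lo≰e  | _        = ≤-reflexive (sym (lost-outside e (λ (lo≤e , _) → lo≰e lo≤e)))
    ... | yes _    | no e≮hi  = ≤-reflexive (sym (lost-outside e (λ (_ , e<hi) → e≮hi e<hi)))

  ∈R⁻ : ∀ {x} → x ∈ R → Σ ℕ λ e → lo ≤ e × e < hi × x ≡ topCell μ e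
  ∈R⁻ x∈ with ∈-applyUpTo⁻ (λ i → topCell μ (lo + i)) x∈
  ... | i , i<n , refl = lo + i , m≤m+n lo i , subst (lo + i <_) lo+n≡hi (+-monoʳ-< lo i<n) , refl

  ∈R⁺ : ∀ e → lo ≤ e → e < hi → topCell μ e ∈ R
  ∈R⁺ e lo≤e e<hi = subst (λ e → topCell μ e ∈ R) (m+[n∸m]≡n lo≤e)
    (∈-applyUpTo⁺ (λ i → topCell μ (lo + i)) (+-cancelˡ-< lo _ _
      (subst₂ _<_ (sym (m+[n∸m]≡n lo≤e)) (sym lo+n≡hi) e<hi)))

  R-removed : ∀ x → x ∈ R → InSD μ x × ¬ InSD ν x
  R-removed x x∈ with ∈R⁻ x∈
  ... | e , lo≤e , e<hi , refl =
    Equivalence.from (InSD-cellOn μ sμ e t (diagLen-pos μ hi∈μ e<hi)) ≤-refl ,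
    λ x∈ν → <⇒≱ (subst (diagLen ν (suc e) <_) (sym (lost-inside e lo≤e e<hi)) ≤-refl)
                (Equivalence.to (InSD-cellOn ν sν e t (diagLen-pos μ hi∈μ e<hi)) x∈ν)
    where
    t = diagLen μ (suc e)

  removed-R : ∀ x → InSD μ x → ¬ InSD ν x → x ∈ R
  removed-R (c , r) x∈μ x∉ν with Equivalence.to (InSD⇔InDiag μ (c , r) sμ) x∈μ
  ... | 1≤r , r≤c , r≤μ = subst (_∈ R) (sym x≡top) (∈R⁺ e (proj₁ inside) (proj₂ inside))
    where
    e = c ∸ r
    ν<r : diagLen ν (suc e) < r
    ν<r = ≰⇒> (λ r≤ν → x∉ν (Equivalence.from (InSD⇔InDiag ν (c , r) sν) (1≤r , r≤c , r≤ν)))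
    inside : lo ≤ e × e < hi
    inside with lo ≤? e | e <? hi
    ... | yes lo≤e | yes e<hi = lo≤e , e<hi
    ... | no lo≰e  | _        = ⊥-elim (<⇒≱ ν<r (subst (r ≤_) (lost-outside e (λ (lo≤e , _) → lo≰e lo≤e)) r≤μ))
    ... | yes _    | no e≮hi  = ⊥-elim (<⇒≱ ν<r (subst (r ≤_) (lost-outside e (λ (_ , e<hi) → e≮hi e<hi)) r≤μ))
    r≡top : r ≡ diagLen μ (suc e)
    r≡top = ≤-antisym r≤μ (subst (_≤ r) (sym (lost-inside e (proj₁ inside) (proj₂ inside))) ν<r)
    x≡top : (c , r) ≡ topCell μ e
    x≡top = cong₂ _,_ (trans (sym (m+[n∸m]≡n r≤c)) (cong (_+ e) r≡top)) r≡top

  path-up : ∀ e j → lo ≤ e → e + j < hi → Path R (topCell μ e) (topCell μ (e + j))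
  path-up e zero lo≤e _ = subst (λ e' → Path R (topCell μ e) (topCell μ e')) (sym (+-identityʳ e)) stop
  path-up e (suc j) lo≤e e+j<hi =
    step (topCell-adjacent μ e sμ) (∈R⁺ (suc e) lo≤e' (≤-<-trans (m≤m+n (suc e) j) e'+j<hi))
      (subst (λ e'' → Path R (topCell μ (suc e)) (topCell μ e'')) (sym (+-suc e j)) (path-up (suc e) j lo≤e' e'+j<hi))
    where
    lo≤e' : lo ≤ suc e
    lo≤e' = m≤n⇒m≤1+n lo≤e
    e'+j<hi : suc e + j < hi
    e'+j<hi = subst (_< hi) (+-suc e j) e+j<hi

  connected : EdgeConnected R
  connected x y x∈ y∈ with ∈R⁻ x∈ | ∈R⁻ y∈
  ... | ex , lo≤ex , ex<hi , refl | ey , lo≤ey , ey<hi , refl with ex ≤? ey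
  ...   | yes ex≤ey = subst (λ e → Path R (topCell μ ex) (topCell μ e)) (m+[n∸m]≡n ex≤ey)
                        (path-up ex (ey ∸ ex) lo≤ex (subst (_< hi) (sym (m+[n∸m]≡n ex≤ey)) ey<hi))
  ...   | no ex≰ey  = path-reverse y∈ (subst (λ e → Path R (topCell μ ey) (topCell μ e)) (m+[n∸m]≡n ey≤ex)
                        (path-up ey (ex ∸ ey) lo≤ey (subst (_< hi) (sym (m+[n∸m]≡n ey≤ex)) ex<hi)))
    where
    ey≤ex : ey ≤ ex
    ey≤ex = <⇒≤ (≰⇒> ex≰ey)

  length-R : length R ≡ hi ∸ lo
  length-R = length-applyUpTo _ n

  single-ribbon : SingleRibbon R
  single-ribbon =
    (λ R≡[] → <⇒≢ (m<n⇒0<n∸m lo<hi) (sym (trans (sym length-R) (cong length R≡[])))) ,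
    connected ,
    (μ , ν , sμ , sν , ν⊆μ , λ x → mk⇔ (R-removed x) (uncurry (removed-R x))) ,
    subst Unique (sym (map-applyUpTo diag (λ i → topCell μ (lo + i)) n))
      (applyUpTo⁺₁ _ n (λ i<j _ eq → <⇒≢ i<j (+-cancelˡ-≡ lo _ _ (suc-injective
        (trans (sym (diag-topCell μ (lo + _))) (trans eq (diag-topCell μ (lo + _))))))))

  removable : Removable μ (_∈ R)
  removable = (λ x x∈ → proj₁ (R-removed x x∈)) , ν , sν ,
    λ x → mk⇔ (rest x) (λ x∈ν → ν⊆μ x x∈ν , λ x∈ → proj₂ (R-removed x x∈) x∈ν)
    where
    rest : ∀ x → InSD μ x × x ∉ R → InSD ν x
    rest x (x∈μ , x∉R) with InSD? ν x
    ... | yes x∈ν = x∈ν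
    ... | no x∉ν  = ⊥-elim (x∉R (removed-R x x∈μ x∉ν))

  diag-R : ∀ {x} → x ∈ R → lo < diag x × diag x ≤ hi
  diag-R x∈ with ∈R⁻ x∈
  ... | e , lo≤e , e<hi , refl = subst (lo <_) (sym (diag-topCell μ e)) (s≤s lo≤e) ,
                                 subst (_≤ hi) (sym (diag-topCell μ e)) e<hi

  head : Σ Cell λ h → IsHead R h × diag h ≡ hi
  head = topCell μ (pred hi) ,
    (∈R⁺ (pred hi) (≤-pred (subst (lo <_) (sym hi≡) lo<hi)) (subst (pred hi <_) hi≡ ≤-refl) ,
     λ x x∈ → subst (diag x ≤_) (sym diag≡) (proj₂ (diag-R x∈))) ,
    diag≡
    where
    hi≡ : suc (pred hi) ≡ hi
    hi≡ = suc-pred hi {{>-nonZero (≤-<-trans z≤n lo<hi)}}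
    diag≡ : diag (topCell μ (pred hi)) ≡ hi
    diag≡ = trans (diag-topCell μ (pred hi)) hi≡

  tail : Σ Cell λ t → IsTail R t × diag t ≡ suc lo
  tail = topCell μ lo ,
    (∈R⁺ lo ≤-refl lo<hi , λ x x∈ → subst (_≤ diag x) (sym (diag-topCell μ lo)) (proj₁ (diag-R x∈))) ,
    diag-topCell μ lo

-- Removing a double ribbon R ∪ S with head on diagonal a: R meets the
-- diagonals 1, …, a and S the diagonals 1, …, b; each diagonal d loses
-- [d ≤ a] + [d ≤ b] cells, whence b < a, a , b ∈ λ and λ \ (R ∪ S) is λ
-- without a and b.

module RemovedDouble (p : List ℕ) (sp : Strict p) (k a : ℕ) (R S : List Cell)
                     (rd : RemovableDouble p k a R S) where

  double : DoubleRibbon p R S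
  double = proj₁ rd

  rm : Removable p (λ x → x ∈ R ⊎ x ∈ S)
  rm = proj₁ (proj₂ (proj₂ rd))

  R⊆p : ∀ x → x ∈ R → InSD p x
  R⊆p x x∈ = proj₁ rm x (inj₁ x∈)

  S⊆p : ∀ x → x ∈ S → InSD p x
  S⊆p x x∈ = proj₁ rm x (inj₂ x∈)

  ν : List ℕ
  ν = remainder p _ rm

  sν : Strict ν
  sν = remainder-strict p _ rm

  open Removal p ν sp sν (λ x → x ∈ R ⊎ x ∈ S) (λ x → (x ∈? R) ⊎-dec (x ∈? S)) (proj₁ rm)
               (remainder-diagram p _ rm)
  module IR = DiagonalInterval (singleRibbon-interval p R R⊆p (proj₁ double))
  module IS = DiagonalInterval (singleRibbon-interval p S S⊆p (proj₁ (proj₂ double)))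

  IR-lo≡0 : IR.lo ≡ 0
  IR-lo≡0 = let (t , tail , _ , t≡1) = proj₁ (proj₂ (proj₂ (proj₂ (proj₂ double))))
            in suc-injective (trans (sym (IR.tail-diag tail)) t≡1)

  IS-lo≡0 : IS.lo ≡ 0
  IS-lo≡0 = let (t , tail , _ , t≡1) = proj₁ (proj₂ (proj₂ (proj₂ (proj₂ (proj₂ double)))))
            in suc-injective (trans (sym (IS.tail-diag tail)) t≡1)

  IR-hi≡a : IR.hi ≡ a
  IR-hi≡a = let (h , head , h≡a) = proj₂ (proj₂ (proj₂ rd)) in trans (sym (IR.head-diag head)) h≡a

  b : ℕ
  b = IS.hi

  length-R : length R ≡ a
  length-R = trans IR.length≡ (cong₂ _∸_ IR-hi≡a IR-lo≡0)

  length-S : length S ≡ b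
  length-S = trans IS.length≡ (cong (b ∸_) IS-lo≡0)

  0<b : 0 < b
  0<b = subst (_< b) IS-lo≡0 IS.lo<hi

  b≤a : b ≤ a
  b≤a = subst₂ _≤_ length-S length-R (proj₁ (proj₂ (proj₂ (proj₂ double))))

  k≡a+b : k ≡ a + b
  k≡a+b = trans (sym (proj₁ (proj₂ rd))) (cong₂ _+_ length-R length-S)

  R-diagonals : ∀ d → 1 ≤ d → d ≤ a → Σ Cell λ x → x ∈ R × diag x ≡ d
  R-diagonals d 1≤d d≤a = IR.onto d (subst (_< d) (sym IR-lo≡0) 1≤d) (subst (d ≤_) (sym IR-hi≡a) d≤a)

  S-diagonals : ∀ d → 1 ≤ d → d ≤ b → Σ Cell λ x → x ∈ S × diag x ≡ d
  S-diagonals d 1≤d d≤b = IS.onto d (subst (_< d) (sym IS-lo≡0) 1≤d) d≤b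

  R-within : ∀ {x} → x ∈ R → diag x ≤ a
  R-within x∈ = subst (_ ≤_) IR-hi≡a (proj₂ (IR.within x∈))

  S-within : ∀ {x} → x ∈ S → diag x ≤ b
  S-within x∈ = proj₂ (IS.within x∈)

  private
    t s : ℕ → ℕ
    t e = diagLen p (suc e)
    s e = diagLen ν (suc e)

  clash-R : ∀ e {i j} → i < j → j ≤ t e → cellOn e (t e ∸ i) ∈ R → cellOn e (t e ∸ j) ∈ R → ⊥
  clash-R e i<j j≤t i∈ j∈ =
    rows-from-top-differ (t e) i<j j≤t (ribbon-one-per-diagonal R (proj₂ (proj₂ (proj₂ (proj₁ double)))) e i∈ j∈)

  clash-S : ∀ e {i j} → i < j → j ≤ t e → cellOn e (t e ∸ i) ∈ S → cellOn e (t e ∸ j) ∈ S → ⊥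
  clash-S e i<j j≤t i∈ j∈ =
    rows-from-top-differ (t e) i<j j≤t (ribbon-one-per-diagonal S (proj₂ (proj₂ (proj₂ (proj₁ (proj₂ double))))) e i∈ j∈)

  lost-one : ∀ e → suc e ≤ a → s e < t e
  lost-one e d≤a with R-diagonals (suc e) z<s d≤a
  ... | x , x∈ , x≡d with removed-rows x (inj₁ x∈)
  ...   | _ , ν<x , x≤p = subst (λ d → diagLen ν d < diagLen p d) x≡d (<-≤-trans ν<x x≤p)

  lost-two : ∀ e → suc e ≤ b → suc (suc (s e)) ≤ t e
  lost-two e d≤b with R-diagonals (suc e) z<s (≤-trans d≤b b≤a) | S-diagonals (suc e) z<s d≤b
  ... | x , x∈R , x≡d | y , y∈S , y≡d =
    subst (λ d → suc (suc (diagLen ν d)) ≤ diagLen p d) x≡d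
      (two-removed x y (inj₁ x∈R) (inj₂ y∈S) (λ x≡y → disjoint x x∈R (subst (_∈ S) (sym x≡y) y∈S)) (trans x≡d (sym y≡d)))
    where disjoint = proj₁ (proj₂ (proj₂ double))

  lost-one⇒ : ∀ e → s e < t e → suc e ≤ a
  lost-one⇒ e lost with top-removed e 0 lost
  ... | inj₁ x∈R = subst (_≤ a) (diag-cellOn e (t e ∸ 0)) (R-within x∈R)
  ... | inj₂ x∈S = ≤-trans (subst (_≤ b) (diag-cellOn e (t e ∸ 0)) (S-within x∈S)) b≤a

  lost-two⇒ : ∀ e → suc (suc (s e)) ≤ t e → suc e ≤ b
  lost-two⇒ e two with top-removed e 0 (<-trans (n<1+n _) two) | top-removed e 1 two
  ... | inj₂ x∈S | _        = subst (_≤ b) (diag-cellOn e (t e ∸ 0)) (S-within x∈S)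
  ... | inj₁ _   | inj₂ y∈S = subst (_≤ b) (diag-cellOn e (t e ∸ 1)) (S-within y∈S)
  ... | inj₁ x∈R | inj₁ y∈R = ⊥-elim (clash-R e z<s (≤-trans (s≤s z≤n) two) x∈R y∈R)

  lost-at-most-two : ∀ e → ¬ suc (suc (suc (s e))) ≤ t e
  lost-at-most-two e three =
    pigeonhole (top-removed e 0 (<-trans (n<1+n _) (<-trans (n<1+n _) three)))
               (top-removed e 1 (<-trans (n<1+n _) three)) (top-removed e 2 three)
    where
    2≤t : 2 ≤ t e
    2≤t = ≤-trans (s≤s (s≤s z≤n)) three
    RemovedRow : ℕ → Set
    RemovedRow j = cellOn e (t e ∸ j) ∈ R ⊎ cellOn e (t e ∸ j) ∈ S
    -- two of the top three rows lie in the same ribbon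
    pigeonhole : RemovedRow 0 → RemovedRow 1 → RemovedRow 2 → ⊥
    pigeonhole (inj₁ c₀) (inj₁ c₁) _         = clash-R e (s≤s z≤n) (≤-trans (n≤1+n 1) 2≤t) c₀ c₁
    pigeonhole (inj₂ c₀) (inj₂ c₁) _         = clash-S e (s≤s z≤n) (≤-trans (n≤1+n 1) 2≤t) c₀ c₁
    pigeonhole (inj₁ c₀) (inj₂ _)  (inj₁ c₂) = clash-R e (s≤s z≤n) 2≤t c₀ c₂
    pigeonhole (inj₂ c₀) (inj₁ _)  (inj₂ c₂) = clash-S e (s≤s z≤n) 2≤t c₀ c₂
    pigeonhole (inj₁ _)  (inj₂ c₁) (inj₂ c₂) = clash-S e (s≤s (s≤s z≤n)) 2≤t c₁ c₂
    pigeonhole (inj₂ _)  (inj₁ c₁) (inj₁ c₂) = clash-R e (s≤s (s≤s z≤n)) 2≤t c₁ c₂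

  profile : ∀ d → 1 ≤ d → diagLen p d ≡ ind d a + (ind d b + diagLen ν d)
  profile (suc e) _ with a <? suc e | b <? suc e
  ... | yes a<d | yes b<d rewrite ind-no a<d | ind-no b<d =
    ≤-antisym (≮⇒≥ (λ lost → <⇒≱ a<d (lost-one⇒ e lost))) (shorter e)
  ... | yes a<d | no b≮d = ⊥-elim (b≮d (≤-<-trans b≤a a<d))
  ... | no a≮d  | yes b<d rewrite ind-yes (≮⇒≥ a≮d) | ind-no b<d =
    ≤-antisym (≮⇒≥ (λ two → <⇒≱ b<d (lost-two⇒ e two))) (lost-one e (≮⇒≥ a≮d))
  ... | no a≮d  | no b≮d rewrite ind-yes (≮⇒≥ a≮d) | ind-yes (≮⇒≥ b≮d) =
    ≤-antisym (≮⇒≥ (lost-at-most-two e)) (lost-two e (≮⇒≥ b≮d))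

  profile-at : ∀ d → 1 ≤ d → ∀ {i j} → ind d a ≡ i → ind d b ≡ j → diagLen p d ≡ i + (j + diagLen ν d)
  profile-at d 1≤d refl refl = profile d 1≤d

  1≤a : 1 ≤ a
  1≤a = ≤-trans 0<b b≤a

  profile-after-a : diagLen p (suc a) ≡ diagLen ν (suc a)
  profile-after-a = profile-at (suc a) z<s (ind-no (n<1+n a)) (ind-no (s≤s b≤a))

  b<a : b < a
  b<a = ≤∧≢⇒< b≤a b≢a
    where
    open ≤-Reasoning
    -- if b = a, diagonal a would lose two cells but diagonal a + 1 none
    b≢a : b ≢ a
    b≢a b≡a = <-irrefl refl (begin
      suc (suc (diagLen ν a))  ≡⟨ sym (profile-at a 1≤a (ind-yes ≤-refl) (ind-yes (≤-reflexive (sym b≡a)))) ⟩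
      diagLen p a              ≤⟨ diagLen-step p a sp ⟩
      suc (diagLen p (suc a))  ≡⟨ cong suc profile-after-a ⟩
      suc (diagLen ν (suc a))  ≤⟨ s≤s (diagLen-antitone ν (n≤1+n a)) ⟩
      suc (diagLen ν a)        ∎)

  part-a : a ∈ p
  part-a = diagLen-drop⁻ p a (begin-strict
    diagLen p (suc a)              ≡⟨ profile-after-a ⟩
    diagLen ν (suc a)              ≤⟨ diagLen-antitone ν (n≤1+n a) ⟩
    diagLen ν a                    ≤⟨ m≤n+m _ (ind a b) ⟩
    ind a b + diagLen ν a          <⟨ n<1+n _ ⟩
    suc (ind a b + diagLen ν a)    ≡⟨ sym (profile-at a 1≤a (ind-yes ≤-refl) refl) ⟩
    diagLen p a                    ∎)
    where open ≤-Reasoning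

  part-b : b ∈ p
  part-b = diagLen-drop⁻ p b (begin-strict
    diagLen p (suc b)              ≡⟨ profile-at (suc b) z<s (ind-yes b<a) (ind-no (n<1+n b)) ⟩
    suc (diagLen ν (suc b))        ≤⟨ s≤s (diagLen-antitone ν (n≤1+n b)) ⟩
    suc (diagLen ν b)              <⟨ n<1+n _ ⟩
    suc (suc (diagLen ν b))        ≡⟨ sym (profile-at b 0<b (ind-yes (<⇒≤ b<a)) (ind-yes ≤-refl)) ⟩
    diagLen p b                    ∎)
    where open ≤-Reasoning

  k∸a≡b : k ∸ a ≡ b
  k∸a≡b = trans (cong (_∸ a) k≡a+b) (m+n∸m≡n a b)

  parts : a ∈ p × (k ∸ a) ∈ p × k ∸ a < a
  parts = part-a , subst (_∈ p) (sym k∸a≡b) part-b , subst (_< a) (sym k∸a≡b) b<a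

  remains-without : ∀ x → (InSD p x × ¬ (x ∈ R ⊎ x ∈ S)) ⇔ InSD (removePart b (removePart a p)) x
  remains-without x = InSD-cong ν removed sν removed-strict diagLen-removed x ⇔-∘ remainder-diagram p _ rm x
    where
    removed : List ℕ
    removed = removePart b (removePart a p)
    removed-strict : Strict removed
    removed-strict = removePart-strict _ b (removePart-strict p a sp)
    diagLen-removed : ∀ e → diagLen ν (suc e) ≡ diagLen removed (suc e)
    diagLen-removed e = +-cancelˡ-≡ (ind d b) _ _ (+-cancelˡ-≡ (ind d a) _ _ (begin
      ind d a + (ind d b + diagLen ν d)           ≡⟨ sym (profile d z<s) ⟩
      diagLen p d                                 ≡⟨ diagLen-removePart p a d part-a ⟩
      ind d a + diagLen (removePart a p) d        ≡⟨ cong (ind d a +_)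
                                                      (diagLen-removePart _ b d (removePart-keeps p a part-b (<⇒≢ b<a))) ⟩
      ind d a + (ind d b + diagLen removed d)     ∎))
      where
      open ≡-Reasoning
      d = suc e

  remains-removed : ∀ x → (InSD p x × ¬ (x ∈ R ⊎ x ∈ S)) ⇔ InSD (removePart (k ∸ a) (removePart a p)) x
  remains-removed x =
    subst (λ c → (InSD p x × ¬ (x ∈ R ⊎ x ∈ S)) ⇔ InSD (removePart c (removePart a p)) x) (sym k∸a≡b) (remains-without x)

single-exists : ∀ p → Strict p → ∀ k m → 1 ≤ k → (m + k) ∈ p → m ∉ p →
  Σ (List Cell) (RemovableSingle p k (m + k))
single-exists p sp k m 1≤k K∈p m∉p =
  R , single-ribbon , trans length-R (m+n∸m≡n m k) , removable , head
  where open TopRibbon p sp m (m + k) (m<m+n m 1≤k) K∈p m∉p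

-- for parts b < a of λ: first strip the top cells of diagonals 1, …, a (this
-- deletes the part a), then those of diagonals 1, …, b of what is left
double-exists : ∀ p → Strict p → ∀ k a → a ∈ p → (k ∸ a) ∈ p → k ∸ a < a →
  Σ (List Cell) λ R → Σ (List Cell) λ S → RemovableDouble p k a R S
double-exists p sp k a a∈p b∈p b<a = R , S , double , length-R+S , removable , First.head
  where
  b = k ∸ a
  0<b : 0 < b
  0<b = strict-pos sp b∈p
  0<a : 0 < a
  0<a = <-trans 0<b b<a
  module First = TopRibbon p sp 0 a 0<a a∈p (strict-0∉ sp)
  b∈ν : b ∈ First.ν
  b∈ν = removePart-keeps p a b∈p (<⇒≢ b<a)
  module Second = TopRibbon First.ν First.sν 0 b 0<b b∈ν (strict-0∉ First.sν)
  R = First.R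
  S = Second.R
  ν⊆p : ∀ x → InSD Second.ν x → InSD p x
  ν⊆p x x∈ = First.ν⊆μ x (Second.ν⊆μ x x∈)
  union-removed : ∀ x → x ∈ R ⊎ x ∈ S → InSD p x × ¬ InSD Second.ν x
  union-removed x (inj₁ x∈R) = proj₁ (First.R-removed x x∈R) , λ x∈ν → proj₂ (First.R-removed x x∈R) (Second.ν⊆μ x x∈ν)
  union-removed x (inj₂ x∈S) = First.ν⊆μ x (proj₁ (Second.R-removed x x∈S)) , proj₂ (Second.R-removed x x∈S)
  removed-union : ∀ x → InSD p x × ¬ InSD Second.ν x → x ∈ R ⊎ x ∈ S
  removed-union x (x∈p , x∉ν) with InSD? First.ν x
  ... | yes x∈ν₁ = inj₂ (Second.removed-R x x∈ν₁ x∉ν)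
  ... | no x∉ν₁  = inj₁ (First.removed-R x x∈p x∉ν₁)
  double : DoubleRibbon p R S
  double =
    First.single-ribbon , Second.single-ribbon ,
    (λ x x∈R x∈S → proj₂ (First.R-removed x x∈R) (proj₁ (Second.R-removed x x∈S))) ,
    subst₂ _≤_ (sym Second.length-R) (sym First.length-R) (<⇒≤ b<a) ,
    (let (t , tail , t≡1) = First.tail in t , tail , proj₁ (First.R-removed t (proj₁ tail)) , t≡1) ,
    (let (t , tail , t≡1) = Second.tail
         t∈ν₁ = proj₁ (Second.R-removed t (proj₁ tail))
     in t , tail , (First.ν⊆μ t t∈ν₁ , λ t∈R → proj₂ (First.R-removed t t∈R) t∈ν₁) , t≡1) ,
    (p , Second.ν , sp , Second.sν , ν⊆p , λ x → mk⇔ (union-removed x) (removed-union x))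
  length-R+S : length R + length S ≡ k
  length-R+S = trans (cong₂ _+_ First.length-R Second.length-R)
                     (m+[n∸m]≡n {a} (≮⇒≥ (λ k<a → <⇒≢ 0<b (sym (m≤n⇒m∸n≡0 (<⇒≤ k<a))))))
  removable : Removable p (λ x → x ∈ R ⊎ x ∈ S)
  removable = (λ x x∈ → proj₁ (union-removed x x∈)) , Second.ν , Second.sν ,
    λ x → mk⇔ (rest x) (λ x∈ν → ν⊆p x x∈ν , λ x∈ → proj₂ (union-removed x x∈) x∈ν)
    where
    rest : ∀ x → InSD p x × ¬ (x ∈ R ⊎ x ∈ S) → InSD Second.ν x
    rest x (x∈p , x∉) with InSD? Second.ν x
    ... | yes x∈ν = x∈ν
    ... | no x∉ν  = ⊥-elim (x∉ (removed-union x (x∈p , x∉ν)))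

-- two removable single ribbons with the same head diagonal coincide, since
-- both have as complement λ with the part m + k replaced by m
single-unique : ∀ p → Strict p → ∀ k m → 1 ≤ k → ∀ R R' →
  RemovableSingle p k (m + k) R → RemovableSingle p k (m + k) R' → ∀ x → x ∈ R ⇔ x ∈ R'
single-unique p sp k m 1≤k R R' rs rs' x = mk⇔ (included R R' rs rs' x) (included R' R rs' rs x)
  where
  module Single = RemovedSingle p sp k m 1≤k
  included : ∀ R R' → RemovableSingle p k (m + k) R → RemovableSingle p k (m + k) R' → ∀ x → x ∈ R → x ∈ R'
  included R R' rs rs' = same-complement p (InSD (replacePart (m + k) m p)) (_∈? R')
    (Single.R⊆p R rs) (Single.remains-replaced R rs) (Single.remains-replaced R' rs')

mainTheorem8 : (p : List ℕ) → Strict p → (k m a : ℕ) → 1 ≤ k →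
    ((Σ (List Cell) (λ R → RemovableSingle p k (m + k) R))
       ⇔ ((m + k) ∈ p × m ∉ p))
    × (∀ R R' → RemovableSingle p k (m + k) R → RemovableSingle p k (m + k) R' →
         ∀ x → x ∈ R ⇔ x ∈ R')
    × (∀ R → RemovableSingle p k (m + k) R →
         ∀ x → (InSD p x × x ∉ R) ⇔ InSD (replacePart (m + k) m p) x)
    × ((Σ (List Cell) (λ R → Σ (List Cell) (λ S → RemovableDouble p k a R S)))
       ⇔ (a ∈ p × (k ∸ a) ∈ p × k ∸ a < a))
    × (∀ R S → RemovableDouble p k a R S →
         ∀ x → (InSD p x × ¬ (x ∈ R ⊎ x ∈ S))
               ⇔ InSD (removePart (k ∸ a) (removePart a p)) x)
mainTheorem8 p sp k m a 1≤k =
  mk⇔ (λ (R , rs) → RemovedSingle.parts p sp k m 1≤k R rs)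
      (uncurry (single-exists p sp k m 1≤k)) ,
  single-unique p sp k m 1≤k ,
  RemovedSingle.remains-replaced p sp k m 1≤k ,
  mk⇔ (λ (R , S , rd) → RemovedDouble.parts p sp k a R S rd)
      (λ (a∈p , b∈p , b<a) → double-exists p sp k a a∈p b∈p b<a) ,
  RemovedDouble.remains-removed p sp k a
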